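{- Let $n_1,n_2,n_3,n_4\ge 2$ be integers and let $G=G_{n_1,n_2,n_3,n_4}$ be the graph whose vertex set is a disjoint union $V_1\sqcup V_2\sqcup V_3\sqcup V_4$ with $|V_i|=n_i$, in which every vertex of $V_i$ is adjacent to every vertex of $V_{i+1}$ for $i=1,2,3$, and there are no other edges. Then $$K(G)\cong(\mathbb{Z}/n_2\mathbb{Z})^{\oplus(n_1-2)}\oplus(\mathbb{Z}/(n_1+n_3)\mathbb{Z})^{\oplus(n_2-2)}\oplus(\mathbb{Z}/(n_2+n_4)\mathbb{Z})^{\oplus(n_3-2)}\oplus(\mathbb{Z}/n_3\mathbb{Z})^{\oplus(n_4-2)}$$ $$\oplus\,\mathbb{Z}/(n_2n_3)\mathbb{Z}\oplus\mathbb{Z}/\big(n_2(n_1+n_3)\big)\mathbb{Z}\oplus\mathbb{Z}/\big(n_3(n_2+n_4)\big)\mathbb{Z}.$$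
   Context: For a finite connected graph $G=(V,E)$, its Laplacian $L(G)$ is the $|V|\times|V|$ matrix with $L(G)_{vv}=\deg v$, $L(G)_{uv}=-1$ if $u\ne v$ are adjacent, and $0$ otherwise. Viewing $L(G)$ as a map $\mathbb{Z}^{V}\to\mathbb{Z}^{V}$, its cokernel has the form $\mathbb{Z}^V/\operatorname{im}L(G)\cong\mathbb{Z}\oplus K(G)$ with $K(G)$ a finite abelian group, called the critical group of $G$. $(\mathbb{Z}/m\mathbb{Z})^{\oplus r}$ denotes the direct sum of $r$ copies of $\mathbb{Z}/m\mathbb{Z}$. -}

module Defs where

open import Data.Nat as ℕ using (ℕ; zero; suc; _≡ᵇ_; _∸_)
open import Data.Integer as ℤ using (ℤ; +_; -_; _+_; _-_; _*_)
open import Data.Fin as Fin using (Fin; splitAt; toℕ)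
open import Data.Sum using (_⊎_; inj₁; inj₂)
open import Data.Bool using (Bool; true; false; if_then_else_; _∨_)
open import Data.List using (List; []; _∷_; _++_; replicate; length)
open import Data.List.Base using (lookup)
open import Data.Product using (∃; _×_; _,_)
open import Relation.Nullary.Decidable using (isYes)
open import Relation.Binary.PropositionalEquality using (_≡_)

Vec : ℕ → Set
Vec n = Fin n → ℤ

Matrix : ℕ → ℕ → Set
Matrix m n = Fin m → Fin n → ℤ

sumFin : {n : ℕ} → (Fin n → ℤ) → ℤ
sumFin {zero}  f = + 0
sumFin {suc n} f = f Fin.zero + sumFin (λ i → f (Fin.suc i))

apply : {m n : ℕ} → Matrix m n → Vec n → Vec m
apply A z i = sumFin (λ j → A i j * z j)

-- The cokernel ℤ^m / im A, as a setoid on ℤ^m: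
-- x ≈ y iff x - y lies in the image of A.
_≈[_]_ : {m n : ℕ} → Vec m → Matrix m n → Vec m → Set
x ≈[ A ] y = ∃ λ z → ∀ i → x i - y i ≡ apply A z i

-- A group isomorphism coker A ≅ coker B, where the groups are the
-- quotients (setoids) ℤ^m / im A and ℤ^k / im B under pointwise addition:
-- a map on representatives which is well defined, additive,
-- injective and surjective on classes.
record CokerIso {m n k l : ℕ} (A : Matrix m n) (B : Matrix k l) : Set where
  field
    f          : Vec m → Vec k
    well-def   : ∀ x y → x ≈[ A ] y → f x ≈[ B ] f y
    additive   : ∀ x y → f (λ i → x i + y i) ≈[ B ] (λ i → f x i + f y i)
    injective  : ∀ x y → f x ≈[ B ] f y → x ≈[ A ] y
    surjective : ∀ w → ∃ λ x → f x ≈[ B ] w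

-- Finite simple graph on vertex set Fin N given by a (symmetric,
-- irreflexive) Boolean adjacency relation, and its Laplacian.
degree : {N : ℕ} → (Fin N → Fin N → Bool) → Fin N → ℤ
degree adj v = sumFin (λ u → if adj u v then + 1 else + 0)

laplacian : {N : ℕ} → (Fin N → Fin N → Bool) → Matrix N N
laplacian adj u v =
  if isYes (u Fin.≟ v) then degree adj v
  else (if adj u v then - (+ 1) else + 0)

-- The graph G_{n1,n2,n3,n4}: vertex set Fin (n1 + (n2 + (n3 + n4))),
-- split into consecutive blocks V1, V2, V3, V4 of sizes n1..n4.
numV : ℕ → ℕ → ℕ → ℕ → ℕ
numV n1 n2 n3 n4 = n1 ℕ.+ (n2 ℕ.+ (n3 ℕ.+ n4))

part : (n1 n2 n3 n4 : ℕ) → Fin (numV n1 n2 n3 n4) → ℕ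
part n1 n2 n3 n4 v with splitAt n1 v
... | inj₁ _ = 0
... | inj₂ w with splitAt n2 w
...   | inj₁ _ = 1
...   | inj₂ w' with splitAt n3 w'
...     | inj₁ _ = 2
...     | inj₂ _ = 3

adjG : (n1 n2 n3 n4 : ℕ) → Fin (numV n1 n2 n3 n4) → Fin (numV n1 n2 n3 n4) → Bool
adjG n1 n2 n3 n4 u v =
  (suc (part n1 n2 n3 n4 u) ≡ᵇ part n1 n2 n3 n4 v) ∨
  (suc (part n1 n2 n3 n4 v) ≡ᵇ part n1 n2 n3 n4 u)

-- Diagonal matrix with diagonal entries given by a list of naturals.
-- Its cokernel is ⊕_i ℤ/d_iℤ (with ℤ/0ℤ = ℤ).
diagM : (ds : List ℕ) → Matrix (length ds) (length ds)
diagM ds i j = if isYes (i Fin.≟ j) then + (lookup ds i) else + 0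

-- List of cyclic orders for  ℤ ⊕ (stated group):
-- 0 (giving the free summand ℤ) followed by the moduli of the theorem.
moduli : ℕ → ℕ → ℕ → ℕ → List ℕ
moduli n1 n2 n3 n4 =
  0 ∷ (replicate (n1 ∸ 2) n2
   ++ replicate (n2 ∸ 2) (n1 ℕ.+ n3)
   ++ replicate (n3 ∸ 2) (n2 ℕ.+ n4)
   ++ replicate (n4 ∸ 2) n3
   ++ (n2 ℕ.* n3) ∷ (n2 ℕ.* (n1 ℕ.+ n3)) ∷ (n3 ℕ.* (n2 ℕ.+ n4)) ∷ [])

-- Let c_j be the entry at the
-- second vertex of the block V_j and S_j the sum over V_j.  The map F on ℤ^V records the total
-- sum (the free summand, as every column of L sums to zero), the differences x_v − c_j for the
-- n_j − 2 vertices v of V_j after the second one (L multiplies such a difference by the common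
-- degree of V_j), and three combinations of the S_j and c_j whose values on L z are multiples of
-- n₂n₃, n₂(n₁+n₃) and n₃(n₂+n₄).  A map G in the other direction satisfies F ∘ G = id and
-- G ∘ F ≡ id modulo im L, and F maps im L onto the image of the diagonal matrix of the moduli.

module Submission where

open import Defs
open import Data.Nat as ℕ using (ℕ; zero; suc; _≡ᵇ_; _≤_; s≤s)
open import Data.Integer as ℤ using (ℤ; +_; -_; _+_; _-_; _*_)
import Data.Integer.Properties as ℤ
open import Data.Integer.Tactic.RingSolver using (solve-∀)
open import Data.Fin as Fin using (Fin; _↑ˡ_; _↑ʳ_)
open import Data.Bool using (Bool; true; false; if_then_else_; _∨_)
open import Data.Bool.Properties using (∨-comm)
open import Data.Fin.Patterns using (0F; 1F; 2F; 3F)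
open import Data.Fin.Properties using (splitAt-↑ˡ; splitAt-↑ʳ)
import Data.Vec.Functional as Vector
open import Data.Vec.Functional.Properties using (lookup-++ˡ; lookup-++ʳ)
open import Data.List using (List; []; _∷_; _++_; replicate; length; lookup)
open import Data.Product using (∃; _,_; proj₁; proj₂)
open import Relation.Nullary.Decidable using (Dec; does; _because_; isYes; yes; no)
open import Relation.Binary.PropositionalEquality
open import Relation.Binary.Bundles using (Setoid)
import Relation.Binary.Reasoning.Setoid as SetoidReasoning
open import Level using (0ℓ)

-- Finite sums

sumFin-cong : ∀ {n} {f g : Fin n → ℤ} → f ≗ g → sumFin f ≡ sumFin g
sumFin-cong {zero}  f≗g = refl
sumFin-cong {suc n} f≗g = cong₂ _+_ (f≗g Fin.zero) (sumFin-cong (λ i → f≗g (Fin.suc i)))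

sumFin-+ : ∀ {n} (f g : Fin n → ℤ) → sumFin (λ i → f i + g i) ≡ sumFin f + sumFin g
sumFin-+ {zero}  f g = refl
sumFin-+ {suc n} f g = begin
  (f₀ + g₀) + sumFin (λ i → f (Fin.suc i) + g (Fin.suc i))
    ≡⟨ cong (_+_ (f₀ + g₀)) (sumFin-+ (λ i → f (Fin.suc i)) (λ i → g (Fin.suc i))) ⟩
  (f₀ + g₀) + (sumFin (λ i → f (Fin.suc i)) + sumFin (λ i → g (Fin.suc i)))
    ≡⟨ interchange f₀ g₀ _ _ ⟩
  (f₀ + sumFin (λ i → f (Fin.suc i))) + (g₀ + sumFin (λ i → g (Fin.suc i))) ∎
  where
  open ≡-Reasoning
  f₀ = f Fin.zero
  g₀ = g Fin.zero
  interchange : ∀ a b c d → (a + b) + (c + d) ≡ (a + c) + (b + d)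
  interchange = solve-∀

sumFin-* : ∀ {n} (c : ℤ) (f : Fin n → ℤ) → sumFin (λ i → c * f i) ≡ c * sumFin f
sumFin-* {zero}  c f = sym (ℤ.*-zeroʳ c)
sumFin-* {suc n} c f =
  trans (cong (_+_ (c * f Fin.zero)) (sumFin-* c (λ i → f (Fin.suc i))))
        (sym (ℤ.*-distribˡ-+ c (f Fin.zero) _))

sumFin-const : ∀ n (c : ℤ) → sumFin {n} (λ _ → c) ≡ + n * c
sumFin-const zero    c = refl
sumFin-const (suc n) c = begin
  c + sumFin {n} (λ _ → c) ≡⟨ cong (_+_ c) (sumFin-const n c) ⟩
  c + + n * c              ≡⟨ cong (λ b → b + + n * c) (ℤ.*-identityˡ c) ⟨
  + 1 * c + + n * c        ≡⟨ ℤ.*-distribʳ-+ c (+ 1) (+ n) ⟨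
  + suc n * c              ∎
  where open ≡-Reasoning

sumFin-↑ : ∀ m n (h : Fin (m ℕ.+ n) → ℤ) →
           sumFin h ≡ sumFin (λ i → h (i ↑ˡ n)) + sumFin (λ j → h (m ↑ʳ j))
sumFin-↑ zero    n h = sym (ℤ.+-identityˡ _)
sumFin-↑ (suc m) n h =
  trans (cong (_+_ (h Fin.zero)) (sumFin-↑ m n (λ i → h (Fin.suc i))))
        (sym (ℤ.+-assoc (h Fin.zero) _ _))

-- isYes is stuck on `Fin.suc p ≟ Fin.suc q`, whereas does computes through map′.
isYes≡does : ∀ {a} {A : Set a} (a? : Dec A) → isYes a? ≡ does a?
isYes≡does (true  because _) = refl
isYes≡does (false because _) = refl

isYes-suc≟suc : ∀ {n} (p q : Fin n) → isYes (Fin.suc p Fin.≟ Fin.suc q) ≡ isYes (p Fin.≟ q)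
isYes-suc≟suc p q = trans (isYes≡does (Fin.suc p Fin.≟ Fin.suc q)) (sym (isYes≡does (p Fin.≟ q)))

sumFin-δ : ∀ {n} (p : Fin n) (a : ℤ) (h : Fin n → ℤ) →
           sumFin (λ q → (if isYes (p Fin.≟ q) then a else + 0) * h q) ≡ a * h p
sumFin-δ {suc n} Fin.zero a h = begin
  a * h Fin.zero + sumFin (λ q → + 0 * h (Fin.suc q))
    ≡⟨ cong (_+_ (a * h Fin.zero)) (sumFin-cong (λ q → ℤ.*-zeroˡ (h (Fin.suc q)))) ⟩
  a * h Fin.zero + sumFin {n} (λ _ → + 0)
    ≡⟨ cong (_+_ (a * h Fin.zero)) (trans (sumFin-const n (+ 0)) (ℤ.*-zeroʳ (+ n))) ⟩
  a * h Fin.zero + + 0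
    ≡⟨ ℤ.+-identityʳ _ ⟩
  a * h Fin.zero ∎
  where open ≡-Reasoning
sumFin-δ {suc n} (Fin.suc p) a h =
  trans (cong₂ _+_ (ℤ.*-zeroˡ (h Fin.zero)) (trans (sumFin-cong shift) (sumFin-δ p a (λ q → h (Fin.suc q)))))
        (ℤ.+-identityˡ _)
  where
  shift : ∀ q → (if isYes (Fin.suc p Fin.≟ Fin.suc q) then a else + 0) * h (Fin.suc q)
              ≡ (if isYes (p Fin.≟ q) then a else + 0) * h (Fin.suc q)
  shift q = cong (λ b → (if b then a else + 0) * h (Fin.suc q)) (isYes-suc≟suc p q)

-- Linear forms and cokernels

infixl 6 _+ᵛ_ _-ᵛ_

_+ᵛ_ _-ᵛ_ : ∀ {n} → Vec n → Vec n → Vec n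
(x +ᵛ y) i = x i + y i
(x -ᵛ y) i = x i - y i

-- Congruence is a field because vectors are functions and only pointwise equality is available.
record LinearForm (n : ℕ) : Set where
  field
    ⟦_⟧     : Vec n → ℤ
    ⟦⟧-cong : ∀ {x y} → x ≗ y → ⟦ x ⟧ ≡ ⟦ y ⟧
    ⟦⟧-+    : ∀ x y → ⟦ x +ᵛ y ⟧ ≡ ⟦ x ⟧ + ⟦ y ⟧

open LinearForm public

⟦⟧-− : ∀ {n} (φ : LinearForm n) x y → ⟦ φ ⟧ (x -ᵛ y) ≡ ⟦ φ ⟧ x - ⟦ φ ⟧ y
⟦⟧-− φ x y = begin
  ⟦ φ ⟧ (x -ᵛ y)                         ≡⟨ add-sub (⟦ φ ⟧ (x -ᵛ y)) (⟦ φ ⟧ y) ⟩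
  ⟦ φ ⟧ (x -ᵛ y) + ⟦ φ ⟧ y - ⟦ φ ⟧ y     ≡⟨ cong (_- ⟦ φ ⟧ y) (⟦⟧-+ φ (x -ᵛ y) y) ⟨
  ⟦ φ ⟧ (x -ᵛ y +ᵛ y) - ⟦ φ ⟧ y          ≡⟨ cong (_- ⟦ φ ⟧ y) (⟦⟧-cong φ (λ i → sub-add (x i) (y i))) ⟩
  ⟦ φ ⟧ x - ⟦ φ ⟧ y                      ∎
  where
  open ≡-Reasoning
  add-sub : ∀ a b → a ≡ a + b - b
  add-sub = solve-∀
  sub-add : ∀ a b → a - b + b ≡ a
  sub-add = solve-∀

infixl 6 _⊕_ _⊖_
infixl 7 _⊛_

coord : ∀ {n} → Fin n → LinearForm n
coord i = record { ⟦_⟧ = λ x → x i ; ⟦⟧-cong = λ x≗y → x≗y i ; ⟦⟧-+ = λ _ _ → refl }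

0ᶠ : ∀ {n} → LinearForm n
0ᶠ = record { ⟦_⟧ = λ _ → + 0 ; ⟦⟧-cong = λ _ → refl ; ⟦⟧-+ = λ _ _ → refl }

sumOver : ∀ {k n} → (Fin k → Fin n) → LinearForm n
sumOver e = record
  { ⟦_⟧     = λ x → sumFin (λ q → x (e q))
  ; ⟦⟧-cong = λ x≗y → sumFin-cong (λ q → x≗y (e q))
  ; ⟦⟧-+    = λ x y → sumFin-+ (λ q → x (e q)) (λ q → y (e q))
  }

sumFin-− : ∀ {n} (f g : Fin n → ℤ) → sumFin (λ i → f i - g i) ≡ sumFin f - sumFin g
sumFin-− = ⟦⟧-− (sumOver (λ i → i))

row : ∀ {m n} → Matrix m n → Fin m → LinearForm n
row A i = record
  { ⟦_⟧     = λ z → apply A z i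
  ; ⟦⟧-cong = λ z≗z′ → sumFin-cong (λ j → cong (A i j *_) (z≗z′ j))
  ; ⟦⟧-+    = λ z z′ → trans (sumFin-cong (λ j → ℤ.*-distribˡ-+ (A i j) (z j) (z′ j)))
                              (sumFin-+ (λ j → A i j * z j) (λ j → A i j * z′ j))
  }

_⊕_ : ∀ {n} → LinearForm n → LinearForm n → LinearForm n
φ ⊕ ψ = record
  { ⟦_⟧     = λ x → ⟦ φ ⟧ x + ⟦ ψ ⟧ x
  ; ⟦⟧-cong = λ x≗y → cong₂ _+_ (⟦⟧-cong φ x≗y) (⟦⟧-cong ψ x≗y)
  ; ⟦⟧-+    = λ x y → trans (cong₂ _+_ (⟦⟧-+ φ x y) (⟦⟧-+ ψ x y))
                            (interchange (⟦ φ ⟧ x) (⟦ φ ⟧ y) (⟦ ψ ⟧ x) (⟦ ψ ⟧ y))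
  }
  where
  interchange : ∀ a b c d → (a + b) + (c + d) ≡ (a + c) + (b + d)
  interchange = solve-∀

_⊖_ : ∀ {n} → LinearForm n → LinearForm n → LinearForm n
φ ⊖ ψ = record
  { ⟦_⟧     = λ x → ⟦ φ ⟧ x - ⟦ ψ ⟧ x
  ; ⟦⟧-cong = λ x≗y → cong₂ _-_ (⟦⟧-cong φ x≗y) (⟦⟧-cong ψ x≗y)
  ; ⟦⟧-+    = λ x y → trans (cong₂ _-_ (⟦⟧-+ φ x y) (⟦⟧-+ ψ x y))
                            (interchange (⟦ φ ⟧ x) (⟦ φ ⟧ y) (⟦ ψ ⟧ x) (⟦ ψ ⟧ y))
  }
  where
  interchange : ∀ a b c d → (a + b) - (c + d) ≡ (a - c) + (b - d)
  interchange = solve-∀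

_⊛_ : ∀ {n} → ℤ → LinearForm n → LinearForm n
c ⊛ φ = record
  { ⟦_⟧     = λ x → c * ⟦ φ ⟧ x
  ; ⟦⟧-cong = λ x≗y → cong (c *_) (⟦⟧-cong φ x≗y)
  ; ⟦⟧-+    = λ x y → trans (cong (c *_) (⟦⟧-+ φ x y)) (ℤ.*-distribˡ-+ c _ _)
  }

infix 30 _⟪_⟫

_⟪_⟫ : ∀ {m n} → (Fin m → LinearForm n) → Vec n → Vec m
(Φ ⟪ x ⟫) i = ⟦ Φ i ⟧ x

⟪⟫-cong : ∀ {m n} (Φ : Fin m → LinearForm n) {x y} → x ≗ y → Φ ⟪ x ⟫ ≗ Φ ⟪ y ⟫
⟪⟫-cong Φ x≗y i = ⟦⟧-cong (Φ i) x≗y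

⟪⟫-− : ∀ {m n} (Φ : Fin m → LinearForm n) x y → Φ ⟪ x -ᵛ y ⟫ ≗ Φ ⟪ x ⟫ -ᵛ Φ ⟪ y ⟫
⟪⟫-− Φ x y i = ⟦⟧-− (Φ i) x y

⟦⟧-0 : ∀ {n} (φ : LinearForm n) → ⟦ φ ⟧ (λ _ → + 0) ≡ + 0
⟦⟧-0 φ = trans (⟦⟧-− φ (λ _ → + 0) (λ _ → + 0)) (ℤ.+-inverseʳ (⟦ φ ⟧ (λ _ → + 0)))

module _ {m n} (A : Matrix m n) where

  ≈-reflexive : ∀ {x y} → x ≗ y → x ≈[ A ] y
  ≈-reflexive {x} {y} x≗y = (λ _ → + 0) , λ i → begin
    x i - y i  ≡⟨ cong (_- y i) (x≗y i) ⟩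
    y i - y i  ≡⟨ ℤ.+-inverseʳ (y i) ⟩
    + 0        ≡⟨ ⟦⟧-0 (row A i) ⟨
    apply A (λ _ → + 0) i ∎
    where open ≡-Reasoning

  ≈-sym : ∀ {x y} → x ≈[ A ] y → y ≈[ A ] x
  ≈-sym {x} {y} (z , x-y≗Az) = (λ _ → + 0) -ᵛ z , λ i → begin
    y i - x i                            ≡⟨ swap (x i) (y i) ⟩
    + 0 - (x i - y i)                    ≡⟨ cong₂ _-_ (sym (⟦⟧-0 (row A i))) (x-y≗Az i) ⟩
    apply A (λ _ → + 0) i - apply A z i  ≡⟨ ⟦⟧-− (row A i) (λ _ → + 0) z ⟨
    apply A ((λ _ → + 0) -ᵛ z) i         ∎
    where
    open ≡-Reasoning
    swap : ∀ a b → b - a ≡ + 0 - (a - b)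
    swap = solve-∀

  ≈-trans : ∀ {x y w} → x ≈[ A ] y → y ≈[ A ] w → x ≈[ A ] w
  ≈-trans {x} {y} {w} (z , x-y≗Az) (z′ , y-w≗Az′) = z +ᵛ z′ , λ i → begin
    x i - w i                    ≡⟨ ℤ.+-minus-telescope (x i) (y i) (w i) ⟨
    (x i - y i) + (y i - w i)    ≡⟨ cong₂ _+_ (x-y≗Az i) (y-w≗Az′ i) ⟩
    apply A z i + apply A z′ i   ≡⟨ ⟦⟧-+ (row A i) z z′ ⟨
    apply A (z +ᵛ z′) i          ∎
    where open ≡-Reasoning

cokernel-setoid : ∀ {m n} → Matrix m n → Setoid 0ℓ 0ℓ
cokernel-setoid {m} A = record
  { Carrier       = Vec m
  ; _≈_           = _≈[ A ]_
  ; isEquivalence = record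
    { refl  = λ {x} → ≈-reflexive A {x} {x} (λ _ → refl)
    ; sym   = λ {x} {y} → ≈-sym A {x} {y}
    ; trans = λ {x} {y} {w} → ≈-trans A {x} {y} {w}
    }
  }

cokerIso-fromInverse :
  ∀ {m n k l} {A : Matrix m n} {B : Matrix k l}
  (F : Fin k → LinearForm m) (G : Fin m → LinearForm k) →
  (∀ z → ∃ λ z′ → F ⟪ apply A z ⟫ ≗ apply B z′) →
  (∀ w → ∃ λ z → F ⟪ apply A z ⟫ ≗ apply B w) →
  (∀ x → x ≈[ A ] G ⟪ F ⟪ x ⟫ ⟫) →
  (∀ w → F ⟪ G ⟪ w ⟫ ⟫ ≗ w) →
  CokerIso A B
cokerIso-fromInverse {A = A} {B} F G F-into F-onto x≈GFx FG≗id = record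
  { f          = F ⟪_⟫
  ; well-def   = well-def
  ; additive   = λ x y → ≈-reflexive B (λ i → ⟦⟧-+ (F i) x y)
  ; injective  = injective
  ; surjective = λ w → G ⟪ w ⟫ , ≈-reflexive B (FG≗id w)
  }
  where
  well-def : ∀ x y → x ≈[ A ] y → F ⟪ x ⟫ ≈[ B ] F ⟪ y ⟫
  well-def x y (z , x-y≗Az) = proj₁ (F-into z) , λ i →
    trans (sym (⟪⟫-− F x y i)) (trans (⟪⟫-cong F x-y≗Az i) (proj₂ (F-into z) i))

  G-into : ∀ w → ∃ λ z → G ⟪ apply B w ⟫ ≗ apply A z
  G-into w with F-onto w
  ... | z , FAz≗Bw with x≈GFx (apply A z)
  ...   | z′ , Az-GFAz≗Az′ = z -ᵛ z′ , λ i → begin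
    ⟦ G i ⟧ (apply B w)            ≡⟨ ⟪⟫-cong G FAz≗Bw i ⟨
    ⟦ G i ⟧ (F ⟪ apply A z ⟫)      ≡⟨ subtract-difference (apply A z i) _ ⟩
    apply A z i - (apply A z i - ⟦ G i ⟧ (F ⟪ apply A z ⟫))
                                   ≡⟨ cong (_-_ (apply A z i)) (Az-GFAz≗Az′ i) ⟩
    apply A z i - apply A z′ i     ≡⟨ ⟦⟧-− (row A i) z z′ ⟨
    apply A (z -ᵛ z′) i            ∎
    where
    open ≡-Reasoning
    subtract-difference : ∀ a b → b ≡ a - (a - b)
    subtract-difference = solve-∀

  injective : ∀ x y → F ⟪ x ⟫ ≈[ B ] F ⟪ y ⟫ → x ≈[ A ] y
  injective x y (w , Fx-Fy≗Bw) =
    begin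
      x              ≈⟨ x≈GFx x ⟩
      G ⟪ F ⟪ x ⟫ ⟫  ≈⟨ GFx≈GFy ⟩
      G ⟪ F ⟪ y ⟫ ⟫  ≈⟨ x≈GFx y ⟨
      y              ∎
    where
    open SetoidReasoning (cokernel-setoid A)
    GFx≈GFy : G ⟪ F ⟪ x ⟫ ⟫ ≈[ A ] G ⟪ F ⟪ y ⟫ ⟫
    GFx≈GFy = proj₁ (G-into w) , λ i →
      trans (sym (⟪⟫-− G (F ⟪ x ⟫) (F ⟪ y ⟫) i))
            (trans (⟪⟫-cong G Fx-Fy≗Bw i) (proj₂ (G-into w) i))

diagM-apply : ∀ ds (w : Vec (length ds)) i → apply (diagM ds) w i ≡ + lookup ds i * w i
diagM-apply ds w i = sumFin-δ i (+ lookup ds i) w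

-- Laplacians

𝟙 : Bool → ℤ
𝟙 b = if b then + 1 else + 0

module _ {N : ℕ} (adj : Fin N → Fin N → Bool) where

  neighbourSum : Fin N → Vec N → ℤ
  neighbourSum u z = sumFin (λ v → 𝟙 (adj u v) * z v)

  laplacian-apply : (∀ u → adj u u ≡ false) → ∀ z u →
    apply (laplacian adj) z u ≡ degree adj u * z u - neighbourSum u z
  laplacian-apply irrefl z u = begin
    apply (laplacian adj) z u
      ≡⟨ sumFin-cong entry ⟩
    sumFin (λ v → δ v * z v - 𝟙 (adj u v) * z v)
      ≡⟨ sumFin-− (λ v → δ v * z v) (λ v → 𝟙 (adj u v) * z v) ⟩
    sumFin (λ v → δ v * z v) - neighbourSum u z
      ≡⟨ cong (_- neighbourSum u z) (sumFin-δ u (degree adj u) z) ⟩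
    degree adj u * z u - neighbourSum u z ∎
    where
    open ≡-Reasoning
    δ : Fin N → ℤ
    δ v = if isYes (u Fin.≟ v) then degree adj u else + 0
    minus-zero : ∀ a b → a ≡ a - + 0 * b
    minus-zero = solve-∀
    minus-one : ∀ b → - (+ 1) * b ≡ + 0 * b - + 1 * b
    minus-one = solve-∀
    entry : ∀ v → laplacian adj u v * z v ≡ δ v * z v - 𝟙 (adj u v) * z v
    entry v with u Fin.≟ v
    ... | yes refl rewrite irrefl u = minus-zero _ (z u)
    ... | no _ with adj u v
    ...   | true  = minus-one (z v)
    ...   | false = minus-zero _ (z v)

  degree-neighbourSum : (∀ u v → adj u v ≡ adj v u) → ∀ u →
    degree adj u ≡ neighbourSum u (λ _ → + 1)
  degree-neighbourSum sym-adj u =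
    sumFin-cong (λ v → trans (cong 𝟙 (sym-adj v u)) (sym (ℤ.*-identityʳ _)))

↑-elim : ∀ m {n} (P : Fin (m ℕ.+ n) → Set) →
         (∀ i → P (i ↑ˡ n)) → (∀ j → P (m ↑ʳ j)) → ∀ v → P v
↑-elim zero    P left right v            = right v
↑-elim (suc m) P left right Fin.zero     = left Fin.zero
↑-elim (suc m) P left right (Fin.suc v) =
  ↑-elim m (λ v → P (Fin.suc v)) (λ i → left (Fin.suc i)) right v

1+n≡ᵇn : ∀ n → (suc n ≡ᵇ n) ≡ false
1+n≡ᵇn zero    = refl
1+n≡ᵇn (suc n) = 1+n≡ᵇn n

-- The graph

-- Block j : Fin 4 is V_{j+1} of the statement, of size n_{j+1}.
module Blocks (size : Fin 4 → ℕ) where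

  n₁ n₂ n₃ n₄ : ℕ
  n₁ = size 0F
  n₂ = size 1F
  n₃ = size 2F
  n₄ = size 3F

  N : ℕ
  N = numV n₁ n₂ n₃ n₄

  ι : (j : Fin 4) → Fin (size j) → Fin N
  ι 0F p = p ↑ˡ (n₂ ℕ.+ (n₃ ℕ.+ n₄))
  ι 1F p = n₁ ↑ʳ (p ↑ˡ (n₃ ℕ.+ n₄))
  ι 2F p = n₁ ↑ʳ (n₂ ↑ʳ (p ↑ˡ n₄))
  ι 3F p = n₁ ↑ʳ (n₂ ↑ʳ (n₃ ↑ʳ p))

  ι-elim : (P : Fin N → Set) → (∀ j p → P (ι j p)) → ∀ v → P v
  ι-elim P h =
    ↑-elim n₁ P (h 0F) (↑-elim n₂ _ (h 1F) (↑-elim n₃ _ (h 2F) (h 3F)))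

  blocks : {A : Set} → ((j : Fin 4) → Fin (size j) → A) → Fin N → A
  blocks h = h 0F Vector.++ (h 1F Vector.++ (h 2F Vector.++ h 3F))

  blocks-ι : {A : Set} (h : (j : Fin 4) → Fin (size j) → A) → ∀ j p → blocks h (ι j p) ≡ h j p
  blocks-ι h 0F p = lookup-++ˡ (h 0F) _ p
  blocks-ι h 1F p = trans (lookup-++ʳ (h 0F) _ _) (lookup-++ˡ (h 1F) _ p)
  blocks-ι h 2F p = trans (lookup-++ʳ (h 0F) _ _)
                          (trans (lookup-++ʳ (h 1F) _ _) (lookup-++ˡ (h 2F) _ p))
  blocks-ι h 3F p = trans (lookup-++ʳ (h 0F) _ _)
                          (trans (lookup-++ʳ (h 1F) _ _) (lookup-++ʳ (h 2F) _ p))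

  blockSum : Fin 4 → LinearForm N
  blockSum j = sumOver (ι j)

  sumFin-blocks : ∀ h → sumFin h ≡ sumFin (λ j → ⟦ blockSum j ⟧ h)
  sumFin-blocks h =
    trans (sumFin-↑ n₁ _ h)
    (cong (_+_ (S 0F)) (trans (sumFin-↑ n₂ _ (λ v → h (n₁ ↑ʳ v)))
    (cong (_+_ (S 1F)) (trans (sumFin-↑ n₃ n₄ (λ v → h (n₁ ↑ʳ (n₂ ↑ʳ v))))
    (cong (_+_ (S 2F)) (sym (ℤ.+-identityʳ (S 3F))))))))
    where
    S : Fin 4 → ℤ
    S j = ⟦ blockSum j ⟧ h

  part-ι : ∀ j p → part n₁ n₂ n₃ n₄ (ι j p) ≡ Fin.toℕ j
  part-ι 0F p rewrite splitAt-↑ˡ n₁ p (n₂ ℕ.+ (n₃ ℕ.+ n₄)) = refl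
  part-ι 1F p rewrite splitAt-↑ʳ n₁ (n₂ ℕ.+ (n₃ ℕ.+ n₄)) (p ↑ˡ (n₃ ℕ.+ n₄))
                    | splitAt-↑ˡ n₂ p (n₃ ℕ.+ n₄) = refl
  part-ι 2F p rewrite splitAt-↑ʳ n₁ (n₂ ℕ.+ (n₃ ℕ.+ n₄)) (n₂ ↑ʳ (p ↑ˡ n₄))
                    | splitAt-↑ʳ n₂ (n₃ ℕ.+ n₄) (p ↑ˡ n₄)
                    | splitAt-↑ˡ n₃ p n₄ = refl
  part-ι 3F p rewrite splitAt-↑ʳ n₁ (n₂ ℕ.+ (n₃ ℕ.+ n₄)) (n₂ ↑ʳ (n₃ ↑ʳ p))
                    | splitAt-↑ʳ n₂ (n₃ ℕ.+ n₄) (n₃ ↑ʳ p)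
                    | splitAt-↑ʳ n₃ n₄ p = refl

  adj : Fin N → Fin N → Bool
  adj = adjG n₁ n₂ n₃ n₄

  adjacentBlocks : Fin 4 → Fin 4 → Bool
  adjacentBlocks j k = (suc (Fin.toℕ j) ≡ᵇ Fin.toℕ k) ∨ (suc (Fin.toℕ k) ≡ᵇ Fin.toℕ j)

  adj-ι : ∀ j p k q → adj (ι j p) (ι k q) ≡ adjacentBlocks j k
  adj-ι j p k q rewrite part-ι j p | part-ι k q = refl

  adj-irrefl : ∀ u → adj u u ≡ false
  adj-irrefl u rewrite 1+n≡ᵇn (part n₁ n₂ n₃ n₄ u) = refl

  adj-sym : ∀ u v → adj u v ≡ adj v u
  adj-sym u v = ∨-comm (suc (part n₁ n₂ n₃ n₄ u) ≡ᵇ part n₁ n₂ n₃ n₄ v)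
                       (suc (part n₁ n₂ n₃ n₄ v) ≡ᵇ part n₁ n₂ n₃ n₄ u)

  nbr : Fin 4 → (Fin 4 → ℤ) → ℤ
  nbr j s = sumFin (λ k → 𝟙 (adjacentBlocks j k) * s k)

  neighbourSum-ι : ∀ j p z → neighbourSum adj (ι j p) z ≡ nbr j (λ k → ⟦ blockSum k ⟧ z)
  neighbourSum-ι j p z =
    trans (sumFin-blocks _) (sumFin-cong λ k →
      trans (sumFin-cong (λ q → cong (λ b → 𝟙 b * z (ι k q)) (adj-ι j p k q)))
            (sumFin-* (𝟙 (adjacentBlocks j k)) (λ q → z (ι k q))))

  deg : Fin 4 → ℤ
  deg j = nbr j (λ k → + size k)

  degree-ι : ∀ j p → degree adj (ι j p) ≡ deg j
  degree-ι j p =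
    trans (degree-neighbourSum adj adj-sym (ι j p))
    (trans (neighbourSum-ι j p _)
           (sumFin-cong (λ k → cong (𝟙 (adjacentBlocks j k) *_)
             (trans (sumFin-const (size k) (+ 1)) (ℤ.*-identityʳ (+ size k))))))

  laplacian-ι : ∀ z j p →
    apply (laplacian adj) z (ι j p) ≡ deg j * z (ι j p) - nbr j (λ k → ⟦ blockSum k ⟧ z)
  laplacian-ι z j p =
    trans (laplacian-apply adj adj-irrefl z (ι j p))
          (cong₂ (λ d s → d * z (ι j p) - s) (degree-ι j p) (neighbourSum-ι j p z))

  nbr-0F : ∀ s → nbr 0F s ≡ s 1F
  nbr-0F s = identity (s 0F) (s 1F) (s 2F) (s 3F)
    where
    identity : ∀ a b c d → + 0 * a + (+ 1 * b + (+ 0 * c + (+ 0 * d + + 0))) ≡ b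
    identity = solve-∀

  nbr-1F : ∀ s → nbr 1F s ≡ s 0F + s 2F
  nbr-1F s = identity (s 0F) (s 1F) (s 2F) (s 3F)
    where
    identity : ∀ a b c d → + 1 * a + (+ 0 * b + (+ 1 * c + (+ 0 * d + + 0))) ≡ a + c
    identity = solve-∀

  nbr-2F : ∀ s → nbr 2F s ≡ s 1F + s 3F
  nbr-2F s = identity (s 0F) (s 1F) (s 2F) (s 3F)
    where
    identity : ∀ a b c d → + 0 * a + (+ 1 * b + (+ 0 * c + (+ 1 * d + + 0))) ≡ b + d
    identity = solve-∀

  nbr-3F : ∀ s → nbr 3F s ≡ s 2F
  nbr-3F s = identity (s 0F) (s 1F) (s 2F) (s 3F)
    where
    identity : ∀ a b c d → + 0 * a + (+ 0 * b + (+ 1 * c + (+ 0 * d + + 0))) ≡ c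
    identity = solve-∀

  blockSum-laplacian : ∀ z j →
    ⟦ blockSum j ⟧ (apply (laplacian adj) z)
      ≡ deg j * ⟦ blockSum j ⟧ z - + size j * nbr j (λ k → ⟦ blockSum k ⟧ z)
  blockSum-laplacian z j =
    trans (sumFin-cong (laplacian-ι z j))
    (trans (sumFin-− (λ p → deg j * z (ι j p)) (λ _ → nbr j (λ k → ⟦ blockSum k ⟧ z)))
           (cong₂ _-_ (sumFin-* (deg j) (λ p → z (ι j p))) (sumFin-const (size j) _)))

-- The moduli

module ReplicatePrefix (a : ℕ) (rest : List ℕ) where

  inj-replicate : ∀ k → Fin k → Fin (length (replicate k a ++ rest))
  inj-replicate (suc k) Fin.zero    = Fin.zero
  inj-replicate (suc k) (Fin.suc t) = Fin.suc (inj-replicate k t)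

  inj-rest : ∀ k → Fin (length rest) → Fin (length (replicate k a ++ rest))
  inj-rest zero    i = i
  inj-rest (suc k) i = Fin.suc (inj-rest k i)

  lookup-inj-replicate : ∀ k t → lookup (replicate k a ++ rest) (inj-replicate k t) ≡ a
  lookup-inj-replicate (suc k) Fin.zero    = refl
  lookup-inj-replicate (suc k) (Fin.suc t) = lookup-inj-replicate k t

  lookup-inj-rest : ∀ k i → lookup (replicate k a ++ rest) (inj-rest k i) ≡ lookup rest i
  lookup-inj-rest zero    i = refl
  lookup-inj-rest (suc k) i = lookup-inj-rest k i

  tabulate : {A : Set} → ∀ k → (Fin k → A) → (Fin (length rest) → A) →
             Fin (length (replicate k a ++ rest)) → A
  tabulate zero    h r i           = r i
  tabulate (suc k) h r Fin.zero    = h Fin.zero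
  tabulate (suc k) h r (Fin.suc i) = tabulate k (λ t → h (Fin.suc t)) r i

  tabulate-inj-replicate : {A : Set} → ∀ k h (r : Fin (length rest) → A) t →
                           tabulate k h r (inj-replicate k t) ≡ h t
  tabulate-inj-replicate (suc k) h r Fin.zero    = refl
  tabulate-inj-replicate (suc k) h r (Fin.suc t) = tabulate-inj-replicate k (λ t → h (Fin.suc t)) r t

  tabulate-inj-rest : {A : Set} → ∀ k h (r : Fin (length rest) → A) i →
                      tabulate k h r (inj-rest k i) ≡ r i
  tabulate-inj-rest zero    h r i = refl
  tabulate-inj-rest (suc k) h r i = tabulate-inj-rest k (λ t → h (Fin.suc t)) r i

  inj-elim : ∀ k (P : Fin (length (replicate k a ++ rest)) → Set) →
             (∀ t → P (inj-replicate k t)) → (∀ i → P (inj-rest k i)) → ∀ i → P i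
  inj-elim zero    P h r i           = r i
  inj-elim (suc k) P h r Fin.zero    = h Fin.zero
  inj-elim (suc k) P h r (Fin.suc i) =
    inj-elim k (λ i → P (Fin.suc i)) (λ t → h (Fin.suc t)) r i

-- Positions in `moduli`: τ₀ for the free summand, τ j t for the n_{j+1} − 2 copies of
-- ℤ/(order j), and τ′ for the last three moduli n₂n₃, n₂(n₁+n₃) and n₃(n₂+n₄).
module Moduli (m₁ m₂ m₃ m₄ : ℕ) where

  n₁ n₂ n₃ n₄ : ℕ
  n₁ = suc (suc m₁)
  n₂ = suc (suc m₂)
  n₃ = suc (suc m₃)
  n₄ = suc (suc m₄)

  m : Fin 4 → ℕ
  m 0F = m₁
  m 1F = m₂
  m 2F = m₃
  m 3F = m₄

  order : Fin 4 → ℕ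
  order 0F = n₂
  order 1F = n₁ ℕ.+ n₃
  order 2F = n₂ ℕ.+ n₄
  order 3F = n₃

  last₃ R₄ R₃ R₂ : List ℕ
  last₃ = n₂ ℕ.* n₃ ∷ n₂ ℕ.* (n₁ ℕ.+ n₃) ∷ n₃ ℕ.* (n₂ ℕ.+ n₄) ∷ []
  R₄ = replicate m₄ (order 3F) ++ last₃
  R₃ = replicate m₃ (order 2F) ++ R₄
  R₂ = replicate m₂ (order 1F) ++ R₃

  module P₁ = ReplicatePrefix (order 0F) R₂
  module P₂ = ReplicatePrefix (order 1F) R₃
  module P₃ = ReplicatePrefix (order 2F) R₄
  module P₄ = ReplicatePrefix (order 3F) last₃

  ds : List ℕ
  ds = moduli n₁ n₂ n₃ n₄

  K : ℕ
  K = length ds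

  τ₀ : Fin K
  τ₀ = Fin.zero

  τ : (j : Fin 4) → Fin (m j) → Fin K
  τ 0F t = Fin.suc (P₁.inj-replicate m₁ t)
  τ 1F t = Fin.suc (P₁.inj-rest m₁ (P₂.inj-replicate m₂ t))
  τ 2F t = Fin.suc (P₁.inj-rest m₁ (P₂.inj-rest m₂ (P₃.inj-replicate m₃ t)))
  τ 3F t = Fin.suc (P₁.inj-rest m₁ (P₂.inj-rest m₂ (P₃.inj-rest m₃ (P₄.inj-replicate m₄ t))))

  τ′ : Fin 3 → Fin K
  τ′ i = Fin.suc (P₁.inj-rest m₁ (P₂.inj-rest m₂ (P₃.inj-rest m₃ (P₄.inj-rest m₄ i))))

  τ-elim : (P : Fin K → Set) → P τ₀ → (∀ j t → P (τ j t)) → (∀ i → P (τ′ i)) → ∀ i → P i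
  τ-elim P p₀ pτ pτ′ Fin.zero    = p₀
  τ-elim P p₀ pτ pτ′ (Fin.suc i) =
    P₁.inj-elim m₁ _ (pτ 0F) (P₂.inj-elim m₂ _ (pτ 1F)
      (P₃.inj-elim m₃ _ (pτ 2F) (P₄.inj-elim m₄ _ (pτ 3F) pτ′))) i

  lookup-τ : ∀ j t → lookup ds (τ j t) ≡ order j
  lookup-τ 0F t = P₁.lookup-inj-replicate m₁ t
  lookup-τ 1F t = trans (P₁.lookup-inj-rest m₁ _) (P₂.lookup-inj-replicate m₂ t)
  lookup-τ 2F t = trans (P₁.lookup-inj-rest m₁ _)
                  (trans (P₂.lookup-inj-rest m₂ _) (P₃.lookup-inj-replicate m₃ t))
  lookup-τ 3F t = trans (P₁.lookup-inj-rest m₁ _)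
                  (trans (P₂.lookup-inj-rest m₂ _)
                  (trans (P₃.lookup-inj-rest m₃ _) (P₄.lookup-inj-replicate m₄ t)))

  lookup-τ′ : ∀ i → lookup ds (τ′ i) ≡ lookup last₃ i
  lookup-τ′ i = trans (P₁.lookup-inj-rest m₁ _)
                (trans (P₂.lookup-inj-rest m₂ _)
                (trans (P₃.lookup-inj-rest m₃ _) (P₄.lookup-inj-rest m₄ i)))

  tabulateK : {A : Set} → A → ((j : Fin 4) → Fin (m j) → A) → (Fin 3 → A) → Fin K → A
  tabulateK a₀ h h′ Fin.zero    = a₀
  tabulateK a₀ h h′ (Fin.suc i) =
    P₁.tabulate m₁ (h 0F) (P₂.tabulate m₂ (h 1F)
      (P₃.tabulate m₃ (h 2F) (P₄.tabulate m₄ (h 3F) h′))) i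

  module _ {A : Set} (a₀ : A) (h : (j : Fin 4) → Fin (m j) → A) (h′ : Fin 3 → A) where

    private
      t₄ = P₄.tabulate m₄ (h 3F) h′
      t₃ = P₃.tabulate m₃ (h 2F) t₄
      t₂ = P₂.tabulate m₂ (h 1F) t₃

    tabulateK-τ : ∀ j t → tabulateK a₀ h h′ (τ j t) ≡ h j t
    tabulateK-τ 0F t = P₁.tabulate-inj-replicate m₁ (h 0F) t₂ t
    tabulateK-τ 1F t = trans (P₁.tabulate-inj-rest m₁ (h 0F) t₂ _)
                             (P₂.tabulate-inj-replicate m₂ (h 1F) t₃ t)
    tabulateK-τ 2F t = trans (P₁.tabulate-inj-rest m₁ (h 0F) t₂ _)
                       (trans (P₂.tabulate-inj-rest m₂ (h 1F) t₃ _)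
                              (P₃.tabulate-inj-replicate m₃ (h 2F) t₄ t))
    tabulateK-τ 3F t = trans (P₁.tabulate-inj-rest m₁ (h 0F) t₂ _)
                       (trans (P₂.tabulate-inj-rest m₂ (h 1F) t₃ _)
                       (trans (P₃.tabulate-inj-rest m₃ (h 2F) t₄ _)
                              (P₄.tabulate-inj-replicate m₄ (h 3F) h′ t)))

    tabulateK-τ′ : ∀ i → tabulateK a₀ h h′ (τ′ i) ≡ h′ i
    tabulateK-τ′ i = trans (P₁.tabulate-inj-rest m₁ (h 0F) t₂ _)
                     (trans (P₂.tabulate-inj-rest m₂ (h 1F) t₃ _)
                     (trans (P₃.tabulate-inj-rest m₃ (h 2F) t₄ _)
                            (P₄.tabulate-inj-rest m₄ (h 3F) h′ i)))

-- The isomorphism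

module Isomorphism (m₁ m₂ m₃ m₄ : ℕ) where

  open Moduli m₁ m₂ m₃ m₄
  size : Fin 4 → ℕ
  size j = suc (suc (m j))

  open Blocks size hiding (n₁; n₂; n₃; n₄)

  L : Matrix N N
  L = laplacian adj

  D : Matrix K K
  D = diagM ds

  one : ∀ {k} → Fin (suc (suc k))
  one = Fin.suc Fin.zero

  two+ : ∀ {k} → Fin k → Fin (suc (suc k))
  two+ t = Fin.suc (Fin.suc t)

  S : Fin 4 → Vec N → ℤ
  S j = ⟦ blockSum j ⟧

  pivot : Fin 4 → LinearForm N
  pivot j = coord (ι j one)

  c : Fin 4 → Vec N → ℤ
  c j = ⟦ pivot j ⟧

  neighbours : Fin 4 → Vec N → ℤ
  neighbours 0F z = S 1F z
  neighbours 1F z = S 0F z + S 2F z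
  neighbours 2F z = S 1F z + S 3F z
  neighbours 3F z = S 2F z

  nbr-blockSums : ∀ j z → nbr j (λ k → S k z) ≡ neighbours j z
  nbr-blockSums 0F z = nbr-0F (λ k → S k z)
  nbr-blockSums 1F z = nbr-1F (λ k → S k z)
  nbr-blockSums 2F z = nbr-2F (λ k → S k z)
  nbr-blockSums 3F z = nbr-3F (λ k → S k z)

  deg≡order : ∀ j → deg j ≡ + order j
  deg≡order 0F = nbr-0F (λ k → + size k)
  deg≡order 1F = nbr-1F (λ k → + size k)
  deg≡order 2F = nbr-2F (λ k → + size k)
  deg≡order 3F = nbr-3F (λ k → + size k)

  L-ι : ∀ z j p → apply L z (ι j p) ≡ + order j * z (ι j p) - neighbours j z
  L-ι z j p = trans (laplacian-ι z j p)
                    (cong₂ (λ d s → d * z (ι j p) - s) (deg≡order j) (nbr-blockSums j z))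

  S-L : ∀ z j → S j (apply L z) ≡ + order j * S j z - + size j * neighbours j z
  S-L z j = trans (blockSum-laplacian z j)
                  (cong₂ (λ d s → d * S j z - + size j * s) (deg≡order j) (nbr-blockSums j z))

  F′ : Fin 3 → LinearForm N
  F′ 0F = blockSum 0F ⊕ blockSum 1F ⊕ + n₃ ⊛ pivot 0F ⊖ + n₂ ⊛ pivot 3F
  F′ 1F = + n₂ ⊛ pivot 1F ⊖ (+ n₁ + + n₃) ⊛ pivot 0F ⊖ blockSum 1F
  F′ 2F = + n₃ ⊛ pivot 2F ⊖ (+ n₂ + + n₄) ⊛ pivot 3F ⊖ blockSum 2F

  Fτ : (j : Fin 4) → Fin (m j) → LinearForm N
  Fτ j t = coord (ι j (two+ t)) ⊖ pivot j

  F₀ : LinearForm N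
  F₀ = blockSum 0F ⊕ blockSum 1F ⊕ blockSum 2F ⊕ blockSum 3F

  F : Fin K → LinearForm N
  F = tabulateK F₀ Fτ F′

  F-τ : ∀ x j t → ⟦ F (τ j t) ⟧ x ≡ x (ι j (two+ t)) - c j x
  F-τ x j t = cong (λ φ → ⟦ φ ⟧ x) (tabulateK-τ F₀ Fτ F′ j t)

  F-τ′ : ∀ x i → ⟦ F (τ′ i) ⟧ x ≡ ⟦ F′ i ⟧ x
  F-τ′ x i = cong (λ φ → ⟦ φ ⟧ x) (tabulateK-τ′ F₀ Fτ F′ i)

  σ′ : Vec N → Fin 3 → ℤ
  σ′ z 0F = c 0F z - c 3F z
  σ′ z 1F = c 1F z - c 0F z
  σ′ z 2F = c 2F z - c 3F z

  στ : Vec N → (j : Fin 4) → Fin (m j) → ℤ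
  στ z j t = z (ι j (two+ t)) - c j z

  -- The modulus at τ₀ is 0, so any value works there; the first vertex of V₁ makes σ surjective.
  σ : Vec N → Vec K
  σ z = tabulateK (z (ι 0F Fin.zero)) (στ z) (σ′ z)

  F-L-τ₀ : ∀ z → ⟦ F τ₀ ⟧ (apply L z) ≡ apply D (σ z) τ₀
  F-L-τ₀ z = begin
    S 0F (apply L z) + S 1F (apply L z) + S 2F (apply L z) + S 3F (apply L z)
      ≡⟨ cong₂ _+_ (cong₂ _+_ (cong₂ _+_ (S-L z 0F) (S-L z 1F)) (S-L z 2F)) (S-L z 3F) ⟩
    (+ n₂ * S 0F z - + n₁ * S 1F z) + ((+ n₁ + + n₃) * S 1F z - + n₂ * (S 0F z + S 2F z))
      + ((+ n₂ + + n₄) * S 2F z - + n₃ * (S 1F z + S 3F z)) + (+ n₃ * S 3F z - + n₄ * S 2F z)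
      ≡⟨ columns-cancel (+ n₁) (+ n₂) (+ n₃) (+ n₄) (S 0F z) (S 1F z) (S 2F z) (S 3F z) ⟩
    + 0
      ≡⟨ ℤ.*-zeroˡ (σ z τ₀) ⟨
    + 0 * σ z τ₀
      ≡⟨ diagM-apply ds (σ z) τ₀ ⟨
    apply D (σ z) τ₀ ∎
    where
    open ≡-Reasoning
    columns-cancel : ∀ n₁ n₂ n₃ n₄ s₀ s₁ s₂ s₃ →
      (n₂ * s₀ - n₁ * s₁) + ((n₁ + n₃) * s₁ - n₂ * (s₀ + s₂))
        + ((n₂ + n₄) * s₂ - n₃ * (s₁ + s₃)) + (n₃ * s₃ - n₄ * s₂) ≡ + 0
    columns-cancel = solve-∀

  F-L-τ : ∀ z j t → ⟦ F (τ j t) ⟧ (apply L z) ≡ apply D (σ z) (τ j t)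
  F-L-τ z j t = begin
    ⟦ F (τ j t) ⟧ (apply L z)
      ≡⟨ F-τ (apply L z) j t ⟩
    apply L z (ι j (two+ t)) - apply L z (ι j one)
      ≡⟨ cong₂ _-_ (L-ι z j (two+ t)) (L-ι z j one) ⟩
    (+ order j * z (ι j (two+ t)) - neighbours j z) - (+ order j * c j z - neighbours j z)
      ≡⟨ neighbours-cancel (+ order j) _ _ _ ⟩
    + order j * (z (ι j (two+ t)) - c j z)
      ≡⟨ cong₂ _*_ (cong +_ (lookup-τ j t)) (tabulateK-τ (z (ι 0F Fin.zero)) (στ z) (σ′ z) j t) ⟨
    + lookup ds (τ j t) * σ z (τ j t)
      ≡⟨ diagM-apply ds (σ z) (τ j t) ⟨
    apply D (σ z) (τ j t) ∎
    where
    open ≡-Reasoning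
    neighbours-cancel : ∀ d a b s → (d * a - s) - (d * b - s) ≡ d * (a - b)
    neighbours-cancel = solve-∀

  F′-L : ∀ z i → ⟦ F′ i ⟧ (apply L z) ≡ + lookup last₃ i * σ′ z i
  F′-L z 0F = begin
    S 0F (apply L z) + S 1F (apply L z) + + n₃ * apply L z (ι 0F one) - + n₂ * apply L z (ι 3F one)
      ≡⟨ cong₂ _-_ (cong₂ _+_ (cong₂ _+_ (S-L z 0F) (S-L z 1F)) (cong (+ n₃ *_) (L-ι z 0F one)))
                   (cong (+ n₂ *_) (L-ι z 3F one)) ⟩
    (+ n₂ * S 0F z - + n₁ * S 1F z) + ((+ n₁ + + n₃) * S 1F z - + n₂ * (S 0F z + S 2F z))
      + + n₃ * (+ n₂ * c 0F z - S 1F z) - + n₂ * (+ n₃ * c 3F z - S 2F z)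
      ≡⟨ identity (+ n₁) (+ n₂) (+ n₃) (S 0F z) (S 1F z) (S 2F z) (c 0F z) (c 3F z) ⟩
    + n₂ * + n₃ * (c 0F z - c 3F z)
      ≡⟨ cong (_* (c 0F z - c 3F z)) (ℤ.pos-* n₂ n₃) ⟨
    + (n₂ ℕ.* n₃) * (c 0F z - c 3F z) ∎
    where
    open ≡-Reasoning
    identity : ∀ n₁ n₂ n₃ s₀ s₁ s₂ a b →
      (n₂ * s₀ - n₁ * s₁) + ((n₁ + n₃) * s₁ - n₂ * (s₀ + s₂)) + n₃ * (n₂ * a - s₁) - n₂ * (n₃ * b - s₂)
        ≡ n₂ * n₃ * (a - b)
    identity = solve-∀
  F′-L z 1F = begin
    + n₂ * apply L z (ι 1F one) - (+ n₁ + + n₃) * apply L z (ι 0F one) - S 1F (apply L z)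
      ≡⟨ cong₂ _-_ (cong₂ _-_ (cong (+ n₂ *_) (L-ι z 1F one)) (cong ((+ n₁ + + n₃) *_) (L-ι z 0F one)))
                   (S-L z 1F) ⟩
    + n₂ * ((+ n₁ + + n₃) * c 1F z - (S 0F z + S 2F z)) - (+ n₁ + + n₃) * (+ n₂ * c 0F z - S 1F z)
      - ((+ n₁ + + n₃) * S 1F z - + n₂ * (S 0F z + S 2F z))
      ≡⟨ identity (+ n₁) (+ n₂) (+ n₃) (S 0F z) (S 1F z) (S 2F z) (c 0F z) (c 1F z) ⟩
    + n₂ * (+ n₁ + + n₃) * (c 1F z - c 0F z)
      ≡⟨ cong (_* (c 1F z - c 0F z)) (ℤ.pos-* n₂ (n₁ ℕ.+ n₃)) ⟨
    + (n₂ ℕ.* (n₁ ℕ.+ n₃)) * (c 1F z - c 0F z) ∎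
    where
    open ≡-Reasoning
    identity : ∀ n₁ n₂ n₃ s₀ s₁ s₂ a b →
      n₂ * ((n₁ + n₃) * b - (s₀ + s₂)) - (n₁ + n₃) * (n₂ * a - s₁) - ((n₁ + n₃) * s₁ - n₂ * (s₀ + s₂))
        ≡ n₂ * (n₁ + n₃) * (b - a)
    identity = solve-∀
  F′-L z 2F = begin
    + n₃ * apply L z (ι 2F one) - (+ n₂ + + n₄) * apply L z (ι 3F one) - S 2F (apply L z)
      ≡⟨ cong₂ _-_ (cong₂ _-_ (cong (+ n₃ *_) (L-ι z 2F one)) (cong ((+ n₂ + + n₄) *_) (L-ι z 3F one)))
                   (S-L z 2F) ⟩
    + n₃ * ((+ n₂ + + n₄) * c 2F z - (S 1F z + S 3F z)) - (+ n₂ + + n₄) * (+ n₃ * c 3F z - S 2F z)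
      - ((+ n₂ + + n₄) * S 2F z - + n₃ * (S 1F z + S 3F z))
      ≡⟨ identity (+ n₂) (+ n₃) (+ n₄) (S 1F z) (S 2F z) (S 3F z) (c 2F z) (c 3F z) ⟩
    + n₃ * (+ n₂ + + n₄) * (c 2F z - c 3F z)
      ≡⟨ cong (_* (c 2F z - c 3F z)) (ℤ.pos-* n₃ (n₂ ℕ.+ n₄)) ⟨
    + (n₃ ℕ.* (n₂ ℕ.+ n₄)) * (c 2F z - c 3F z) ∎
    where
    open ≡-Reasoning
    identity : ∀ n₂ n₃ n₄ s₁ s₂ s₃ a b →
      n₃ * ((n₂ + n₄) * a - (s₁ + s₃)) - (n₂ + n₄) * (n₃ * b - s₂) - ((n₂ + n₄) * s₂ - n₃ * (s₁ + s₃))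
        ≡ n₃ * (n₂ + n₄) * (a - b)
    identity = solve-∀

  F-L-τ′ : ∀ z i → ⟦ F (τ′ i) ⟧ (apply L z) ≡ apply D (σ z) (τ′ i)
  F-L-τ′ z i = begin
    ⟦ F (τ′ i) ⟧ (apply L z)           ≡⟨ F-τ′ (apply L z) i ⟩
    ⟦ F′ i ⟧ (apply L z)               ≡⟨ F′-L z i ⟩
    + lookup last₃ i * σ′ z i          ≡⟨ cong₂ _*_ (cong +_ (lookup-τ′ i)) (tabulateK-τ′ (z (ι 0F Fin.zero)) (στ z) (σ′ z) i) ⟨
    + lookup ds (τ′ i) * σ z (τ′ i)    ≡⟨ diagM-apply ds (σ z) (τ′ i) ⟨
    apply D (σ z) (τ′ i)               ∎
    where open ≡-Reasoning

  F-laplacian : ∀ z → F ⟪ apply L z ⟫ ≗ apply D (σ z)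
  F-laplacian z = τ-elim _ (F-L-τ₀ z) (F-L-τ z) (F-L-τ′ z)

  σ-surjective : ∀ w → ∃ λ z → σ z ≗ w
  σ-surjective w = blocks preimage , τ-elim _ (blocks-ι preimage 0F Fin.zero) at-τ at-τ′
    where
    γ : Fin 4 → ℤ
    γ 0F = w (τ′ 0F)
    γ 1F = w (τ′ 0F) + w (τ′ 1F)
    γ 2F = w (τ′ 2F)
    γ 3F = + 0

    preimage : (j : Fin 4) → Fin (size j) → ℤ
    preimage j  (Fin.suc Fin.zero)    = γ j
    preimage j  (Fin.suc (Fin.suc t)) = w (τ j t) + γ j
    preimage 0F Fin.zero              = w τ₀
    preimage _  Fin.zero              = + 0

    z : Vec N
    z = blocks preimage

    c-z : ∀ j → c j z ≡ γ j
    c-z j = blocks-ι preimage j one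

    add-sub : ∀ a b → a + b - b ≡ a
    add-sub = solve-∀

    at-τ : ∀ j t → σ z (τ j t) ≡ w (τ j t)
    at-τ j t = trans (tabulateK-τ (z (ι 0F Fin.zero)) (στ z) (σ′ z) j t)
               (trans (cong₂ _-_ (blocks-ι preimage j (two+ t)) (c-z j)) (add-sub _ (γ j)))

    σ′-z : ∀ i → σ′ z i ≡ w (τ′ i)
    σ′-z 0F = trans (cong₂ _-_ (c-z 0F) (c-z 3F)) (ℤ.+-identityʳ _)
    σ′-z 1F = trans (cong₂ _-_ (c-z 1F) (c-z 0F)) (sub-cancelˡ (w (τ′ 0F)) (w (τ′ 1F)))
      where
      sub-cancelˡ : ∀ a b → a + b - a ≡ b
      sub-cancelˡ = solve-∀
    σ′-z 2F = trans (cong₂ _-_ (c-z 2F) (c-z 3F)) (ℤ.+-identityʳ _)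

    at-τ′ : ∀ i → σ z (τ′ i) ≡ w (τ′ i)
    at-τ′ i = trans (tabulateK-τ′ (z (ι 0F Fin.zero)) (στ z) (σ′ z) i) (σ′-z i)

  T : Fin 4 → LinearForm K
  T j = sumOver (τ j)

  W′ : Fin 3 → LinearForm K
  W′ i = coord (τ′ i)

  G₀ : Fin 4 → LinearForm K
  G₀ 0F = W′ 0F ⊕ W′ 1F ⊖ T 0F
  G₀ 1F = 0ᶠ ⊖ W′ 1F ⊖ T 1F
  G₀ 2F = 0ᶠ ⊖ W′ 2F ⊖ T 2F
  G₀ 3F = coord τ₀ ⊖ W′ 0F ⊕ W′ 2F ⊖ T 3F

  Gι : (j : Fin 4) → Fin (size j) → LinearForm K
  Gι j (Fin.suc Fin.zero)    = 0ᶠ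
  Gι j (Fin.suc (Fin.suc t)) = coord (τ j t)
  Gι j Fin.zero              = G₀ j

  G : Fin N → LinearForm K
  G = blocks Gι

  G-ι : ∀ w j p → ⟦ G (ι j p) ⟧ w ≡ ⟦ Gι j p ⟧ w
  G-ι w j p = cong (λ φ → ⟦ φ ⟧ w) (blocks-ι Gι j p)

  S-G : ∀ w j → S j (G ⟪ w ⟫) ≡ ⟦ G₀ j ⟧ w + (+ 0 + ⟦ T j ⟧ w)
  S-G w j = sumFin-cong (G-ι w j)

  F′-G : ∀ w i → ⟦ F′ i ⟧ (G ⟪ w ⟫) ≡ w (τ′ i)
  F′-G w 0F = begin
    S 0F Gw + S 1F Gw + + n₃ * c 0F Gw - + n₂ * c 3F Gw
      ≡⟨ cong₂ _-_ (cong₂ _+_ (cong₂ _+_ (S-G w 0F) (S-G w 1F)) (cong (+ n₃ *_) (G-ι w 0F one)))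
                   (cong (+ n₂ *_) (G-ι w 3F one)) ⟩
    (W 0F + W 1F - T′ 0F + (+ 0 + T′ 0F)) + (+ 0 - W 1F - T′ 1F + (+ 0 + T′ 1F))
      + + n₃ * + 0 - + n₂ * + 0
      ≡⟨ identity (+ n₂) (+ n₃) (W 0F) (W 1F) (T′ 0F) (T′ 1F) ⟩
    W 0F ∎
    where
    open ≡-Reasoning
    Gw = G ⟪ w ⟫
    W = λ i → w (τ′ i)
    T′ = λ j → ⟦ T j ⟧ w
    identity : ∀ n₂ n₃ a b s t →
      (a + b - s + (+ 0 + s)) + (+ 0 - b - t + (+ 0 + t)) + n₃ * + 0 - n₂ * + 0 ≡ a
    identity = solve-∀
  F′-G w 1F = begin
    + n₂ * c 1F Gw - (+ n₁ + + n₃) * c 0F Gw - S 1F Gw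
      ≡⟨ cong₂ _-_ (cong₂ _-_ (cong (+ n₂ *_) (G-ι w 1F one)) (cong ((+ n₁ + + n₃) *_) (G-ι w 0F one)))
                   (S-G w 1F) ⟩
    + n₂ * + 0 - (+ n₁ + + n₃) * + 0 - (+ 0 - w (τ′ 1F) - ⟦ T 1F ⟧ w + (+ 0 + ⟦ T 1F ⟧ w))
      ≡⟨ identity (+ n₂) (+ n₁ + + n₃) (w (τ′ 1F)) (⟦ T 1F ⟧ w) ⟩
    w (τ′ 1F) ∎
    where
    open ≡-Reasoning
    Gw = G ⟪ w ⟫
    identity : ∀ d d′ b t → d * + 0 - d′ * + 0 - (+ 0 - b - t + (+ 0 + t)) ≡ b
    identity = solve-∀
  F′-G w 2F = begin
    + n₃ * c 2F Gw - (+ n₂ + + n₄) * c 3F Gw - S 2F Gw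
      ≡⟨ cong₂ _-_ (cong₂ _-_ (cong (+ n₃ *_) (G-ι w 2F one)) (cong ((+ n₂ + + n₄) *_) (G-ι w 3F one)))
                   (S-G w 2F) ⟩
    + n₃ * + 0 - (+ n₂ + + n₄) * + 0 - (+ 0 - w (τ′ 2F) - ⟦ T 2F ⟧ w + (+ 0 + ⟦ T 2F ⟧ w))
      ≡⟨ identity (+ n₃) (+ n₂ + + n₄) (w (τ′ 2F)) (⟦ T 2F ⟧ w) ⟩
    w (τ′ 2F) ∎
    where
    open ≡-Reasoning
    Gw = G ⟪ w ⟫
    identity : ∀ d d′ b t → d * + 0 - d′ * + 0 - (+ 0 - b - t + (+ 0 + t)) ≡ b
    identity = solve-∀

  F-G-τ₀ : ∀ w → ⟦ F τ₀ ⟧ (G ⟪ w ⟫) ≡ w τ₀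
  F-G-τ₀ w = begin
    S 0F Gw + S 1F Gw + S 2F Gw + S 3F Gw
      ≡⟨ cong₂ _+_ (cong₂ _+_ (cong₂ _+_ (S-G w 0F) (S-G w 1F)) (S-G w 2F)) (S-G w 3F) ⟩
    (W 0F + W 1F - T′ 0F + (+ 0 + T′ 0F)) + (+ 0 - W 1F - T′ 1F + (+ 0 + T′ 1F))
      + (+ 0 - W 2F - T′ 2F + (+ 0 + T′ 2F)) + (w τ₀ - W 0F + W 2F - T′ 3F + (+ 0 + T′ 3F))
      ≡⟨ identity (w τ₀) (W 0F) (W 1F) (W 2F) (T′ 0F) (T′ 1F) (T′ 2F) (T′ 3F) ⟩
    w τ₀ ∎
    where
    open ≡-Reasoning
    Gw = G ⟪ w ⟫
    W = λ i → w (τ′ i)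
    T′ = λ j → ⟦ T j ⟧ w
    identity : ∀ w₀ a b d t₀ t₁ t₂ t₃ →
      (a + b - t₀ + (+ 0 + t₀)) + (+ 0 - b - t₁ + (+ 0 + t₁))
        + (+ 0 - d - t₂ + (+ 0 + t₂)) + (w₀ - a + d - t₃ + (+ 0 + t₃)) ≡ w₀
    identity = solve-∀

  F∘G≗id : ∀ w → F ⟪ G ⟪ w ⟫ ⟫ ≗ w
  F∘G≗id w = τ-elim _ (F-G-τ₀ w) at-τ (λ i → trans (F-τ′ (G ⟪ w ⟫) i) (F′-G w i))
    where
    at-τ : ∀ j t → ⟦ F (τ j t) ⟧ (G ⟪ w ⟫) ≡ w (τ j t)
    at-τ j t = trans (F-τ (G ⟪ w ⟫) j t)
               (trans (cong₂ _-_ (G-ι w j (two+ t)) (G-ι w j one)) (ℤ.+-identityʳ (w (τ j t))))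

  module _ (x : Vec N) where

    R : Fin 4 → ℤ
    R j = sumFin (λ t → x (ι j (two+ t)))

    T-F : ∀ j → ⟦ T j ⟧ (F ⟪ x ⟫) ≡ R j - + m j * c j x
    T-F j = trans (sumFin-cong (F-τ x j))
            (trans (sumFin-− (λ t → x (ι j (two+ t))) (λ _ → c j x))
                   (cong (_-_ (R j)) (sumFin-const (m j) (c j x))))

    -- Put on the first vertex of block j, κ makes neighbours j equal to − c j x.
    κ : Fin 4 → ℤ
    κ 0F = c 3F x - c 1F x
    κ 1F = - c 0F x
    κ 2F = - c 3F x
    κ 3F = c 0F x - c 2F x

    x-G∘F-first : ∀ j → x (ι j Fin.zero) - ⟦ G₀ j ⟧ (F ⟪ x ⟫) ≡ + order j * κ j - - c j x
    x-G∘F-first 0F = begin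
      x (ι 0F Fin.zero) - (⟦ F (τ′ 0F) ⟧ x + ⟦ F (τ′ 1F) ⟧ x - ⟦ T 0F ⟧ (F ⟪ x ⟫))
        ≡⟨ cong (_-_ (x (ι 0F Fin.zero))) (cong₂ _-_ (cong₂ _+_ (F-τ′ x 0F) (F-τ′ x 1F)) (T-F 0F)) ⟩
      x (ι 0F Fin.zero) - (⟦ F′ 0F ⟧ x + ⟦ F′ 1F ⟧ x - (R 0F - + m₁ * c 0F x))
        ≡⟨ identity (+ m₁) (+ n₂) (+ n₃) (x (ι 0F Fin.zero)) (c 0F x) (R 0F) (S 1F x) (c 1F x) (c 3F x) ⟩
      + n₂ * (c 3F x - c 1F x) - - c 0F x ∎
      where
      open ≡-Reasoning
      identity : ∀ m₁ n₂ n₃ a c₀ r s₁ c₁ c₃ →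
        a - ((a + (c₀ + r)) + s₁ + n₃ * c₀ - n₂ * c₃ + (n₂ * c₁ - ((+ 2 + m₁) + n₃) * c₀ - s₁)
             - (r - m₁ * c₀))
          ≡ n₂ * (c₃ - c₁) - - c₀
      identity = solve-∀
    x-G∘F-first 1F = begin
      x (ι 1F Fin.zero) - (+ 0 - ⟦ F (τ′ 1F) ⟧ x - ⟦ T 1F ⟧ (F ⟪ x ⟫))
        ≡⟨ cong (_-_ (x (ι 1F Fin.zero))) (cong₂ _-_ (cong (_-_ (+ 0)) (F-τ′ x 1F)) (T-F 1F)) ⟩
      x (ι 1F Fin.zero) - (+ 0 - ⟦ F′ 1F ⟧ x - (R 1F - + m₂ * c 1F x))
        ≡⟨ identity (+ m₂) (+ n₁ + + n₃) (x (ι 1F Fin.zero)) (c 1F x) (R 1F) (c 0F x) ⟩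
      (+ n₁ + + n₃) * - c 0F x - - c 1F x ∎
      where
      open ≡-Reasoning
      identity : ∀ m₂ d a c₁ r c₀ →
        a - (+ 0 - ((+ 2 + m₂) * c₁ - d * c₀ - (a + (c₁ + r))) - (r - m₂ * c₁)) ≡ d * - c₀ - - c₁
      identity = solve-∀
    x-G∘F-first 2F = begin
      x (ι 2F Fin.zero) - (+ 0 - ⟦ F (τ′ 2F) ⟧ x - ⟦ T 2F ⟧ (F ⟪ x ⟫))
        ≡⟨ cong (_-_ (x (ι 2F Fin.zero))) (cong₂ _-_ (cong (_-_ (+ 0)) (F-τ′ x 2F)) (T-F 2F)) ⟩
      x (ι 2F Fin.zero) - (+ 0 - ⟦ F′ 2F ⟧ x - (R 2F - + m₃ * c 2F x))
        ≡⟨ identity (+ m₃) (+ n₂ + + n₄) (x (ι 2F Fin.zero)) (c 2F x) (R 2F) (c 3F x) ⟩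
      (+ n₂ + + n₄) * - c 3F x - - c 2F x ∎
      where
      open ≡-Reasoning
      identity : ∀ m₃ d a c₂ r c₃ →
        a - (+ 0 - ((+ 2 + m₃) * c₂ - d * c₃ - (a + (c₂ + r))) - (r - m₃ * c₂)) ≡ d * - c₃ - - c₂
      identity = solve-∀
    x-G∘F-first 3F = begin
      x (ι 3F Fin.zero) - (⟦ F τ₀ ⟧ x - ⟦ F (τ′ 0F) ⟧ x + ⟦ F (τ′ 2F) ⟧ x - ⟦ T 3F ⟧ (F ⟪ x ⟫))
        ≡⟨ cong (_-_ (x (ι 3F Fin.zero)))
             (cong₂ _-_ (cong₂ _+_ (cong (_-_ (⟦ F τ₀ ⟧ x)) (F-τ′ x 0F)) (F-τ′ x 2F)) (T-F 3F)) ⟩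
      x (ι 3F Fin.zero) - (⟦ F₀ ⟧ x - ⟦ F′ 0F ⟧ x + ⟦ F′ 2F ⟧ x - (R 3F - + m₄ * c 3F x))
        ≡⟨ identity (+ m₄) (+ n₂) (+ n₃) (S 0F x) (S 1F x) (S 2F x)
                    (x (ι 3F Fin.zero)) (c 3F x) (R 3F) (c 0F x) (c 2F x) ⟩
      + n₃ * (c 0F x - c 2F x) - - c 3F x ∎
      where
      open ≡-Reasoning
      identity : ∀ m₄ n₂ n₃ s₀ s₁ s₂ a c₃ r c₀ c₂ →
        a - (s₀ + s₁ + s₂ + (a + (c₃ + r)) - (s₀ + s₁ + n₃ * c₀ - n₂ * c₃)
             + (n₃ * c₂ - (n₂ + (+ 2 + m₄)) * c₃ - s₂) - (r - m₄ * c₃))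
          ≡ n₃ * (c₀ - c₂) - - c₃
      identity = solve-∀

    correction : (j : Fin 4) → Fin (size j) → ℤ
    correction j Fin.zero    = κ j
    correction j (Fin.suc _) = + 0

    S-correction : ∀ j → S j (blocks correction) ≡ κ j
    S-correction j = begin
      S j (blocks correction)
        ≡⟨ sumFin-cong (blocks-ι correction j) ⟩
      κ j + (+ 0 + sumFin {m j} (λ _ → + 0))
        ≡⟨ cong (λ s → κ j + (+ 0 + s)) (trans (sumFin-const (m j) (+ 0)) (ℤ.*-zeroʳ (+ m j))) ⟩
      κ j + + 0
        ≡⟨ ℤ.+-identityʳ (κ j) ⟩
      κ j ∎
      where open ≡-Reasoning

    neighbours-correction : ∀ j → neighbours j (blocks correction) ≡ - c j x
    neighbours-correction 0F = S-correction 1F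
    neighbours-correction 1F =
      trans (cong₂ _+_ (S-correction 0F) (S-correction 2F)) (identity (c 1F x) (c 3F x))
      where
      identity : ∀ c₁ c₃ → c₃ - c₁ + - c₃ ≡ - c₁
      identity = solve-∀
    neighbours-correction 2F =
      trans (cong₂ _+_ (S-correction 1F) (S-correction 3F)) (identity (c 0F x) (c 2F x))
      where
      identity : ∀ c₀ c₂ → - c₀ + (c₀ - c₂) ≡ - c₂
      identity = solve-∀
    neighbours-correction 3F = S-correction 2F

    x-G∘F-ι : ∀ j p → x (ι j p) - ⟦ Gι j p ⟧ (F ⟪ x ⟫) ≡ + order j * correction j p - - c j x
    x-G∘F-ι j Fin.zero            = x-G∘F-first j
    x-G∘F-ι j (Fin.suc Fin.zero) = identity (+ order j) (c j x)
      where
      identity : ∀ d c → c - + 0 ≡ d * + 0 - - c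
      identity = solve-∀
    x-G∘F-ι j (Fin.suc (Fin.suc t)) =
      trans (cong (_-_ (x (ι j (two+ t)))) (F-τ x j t)) (identity (+ order j) (x (ι j (two+ t))) (c j x))
      where
      identity : ∀ d a c → a - (a - c) ≡ d * + 0 - - c
      identity = solve-∀

    x≈G∘F : x ≈[ L ] G ⟪ F ⟪ x ⟫ ⟫
    x≈G∘F = blocks correction , ι-elim _ λ j p → begin
      x (ι j p) - ⟦ G (ι j p) ⟧ (F ⟪ x ⟫)
        ≡⟨ cong (_-_ (x (ι j p))) (G-ι (F ⟪ x ⟫) j p) ⟩
      x (ι j p) - ⟦ Gι j p ⟧ (F ⟪ x ⟫)
        ≡⟨ x-G∘F-ι j p ⟩
      + order j * correction j p - - c j x
        ≡⟨ cong₂ (λ a b → + order j * a - b) (blocks-ι correction j p) (neighbours-correction j) ⟨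
      + order j * blocks correction (ι j p) - neighbours j (blocks correction)
        ≡⟨ L-ι (blocks correction) j p ⟨
      apply L (blocks correction) (ι j p) ∎
      where open ≡-Reasoning

  cokerIso : CokerIso L D
  cokerIso = cokerIso-fromInverse F G
    (λ z → σ z , F-laplacian z)
    (λ w → let z , σz≗w = σ-surjective w in
           z , λ i → trans (F-laplacian z i) (⟪⟫-cong (row D) σz≗w i))
    x≈G∘F
    F∘G≗id

mainTheorem3 : (n1 n2 n3 n4 : ℕ) → 2 ≤ n1 → 2 ≤ n2 → 2 ≤ n3 → 2 ≤ n4 →
    CokerIso (laplacian (adjG n1 n2 n3 n4)) (diagM (moduli n1 n2 n3 n4))
mainTheorem3 _ _ _ _ (s≤s (s≤s {n = m₁} _)) (s≤s (s≤s {n = m₂} _))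
                     (s≤s (s≤s {n = m₃} _)) (s≤s (s≤s {n = m₄} _)) =
  Isomorphism.cokerIso m₁ m₂ m₃ m₄
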